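{- $\mathrm{SYM}\circ\mathrm{AND}\subseteq k\mathrm{NN}$.
   Context: All classes are classes of families of Boolean functions on $\{0,1\}^n$; "polynomial" means polynomial in $n$. $\mathrm{SYM}\circ\mathrm{AND}$ is the class of functions $f(\mathbf{x})=g(h_1(\mathbf{x}),\dots,h_s(\mathbf{x}))$ where $s$ is polynomial, each $h_i$ is an AND of literals (variables or negated variables) or constants, and $g:\{0,1\}^s\to\{0,1\}$ is symmetric (depends only on the Hamming weight of its input). Let $\Delta(\mathbf{x},\mathbf{y})=\|\mathbf{x}-\mathbf{y}\|_2^2$. A $k$-nearest neighbors representation of $f$ consists of disjoint finite sets $P,N\subseteq\mathbb{R}^n$ (anchors) and a positive integer $k$ such that $f(\mathbf{x})=1$ iff there exists $A\subseteq P\cup N$ with $|A|=k$, $|A\cap P|\ge|A\cap N|$, and $\Delta(\mathbf{x},\mathbf{a})<\Delta(\mathbf{x},\mathbf{b})$ for all $\mathbf{a}\in A$, $\mathbf{b}\notin A$. $k\mathrm{NN}$ is the class of functions having a $k$-nearest neighbors representation (for some positive integer $k$) with polynomially many anchors. -}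

module Defs where

open import Data.Bool using (Bool; true; false; _∧_; not; if_then_else_)
open import Data.Nat using (ℕ; zero; suc; _+_; _^_; _≤_)
open import Data.Fin using (Fin)
open import Data.Vec using (Vec; lookup; zipWith; foldr; toList)
open import Data.List using (List; []; _∷_; length; _++_)
open import Data.List.Membership.Propositional using (_∈_; _∉_)
open import Data.List.Relation.Unary.Unique.Propositional using (Unique)
open import Data.Rational using (ℚ; 0ℚ; 1ℚ; _<_) renaming (_+_ to _+ℚ_; _*_ to _*ℚ_; _-_ to _-ℚ_)
open import Data.Product using (Σ; ∃; ∃-syntax; _×_)
open import Relation.Binary.PropositionalEquality using (_≡_)

PolyBounded : (ℕ → ℕ) → Set
PolyBounded s = ∃[ c ] (∀ n → s n ≤ n ^ c + c)

BoolFamily : Set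
BoolFamily = (n : ℕ) → Vec Bool n → Bool

data Lit (n : ℕ) : Set where
  pos : Fin n → Lit n
  neg : Fin n → Lit n
  cst : Bool → Lit n

evalLit : ∀ {n} → Lit n → Vec Bool n → Bool
evalLit (pos i) x = lookup x i
evalLit (neg i) x = not (lookup x i)
evalLit (cst b) x = b

AndTerm : ℕ → Set
AndTerm n = List (Lit n)

evalAnd : ∀ {n} → AndTerm n → Vec Bool n → Bool
evalAnd []       x = true
evalAnd (l ∷ t) x = evalLit l x ∧ evalAnd t x

weight : ∀ {s} → Vec Bool s → ℕ
weight = foldr _ (λ b w → if b then suc w else w) 0

Symmetric : ∀ {s} → (Vec Bool s → Bool) → Set
Symmetric {s} g = (y z : Vec Bool s) → weight y ≡ weight z → g y ≡ g z

SYM∘AND : BoolFamily → Set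
SYM∘AND f =
  Σ (ℕ → ℕ) λ s → PolyBounded s ×
  ((n : ℕ) → Σ (Vec Bool (s n) → Bool) λ g → Symmetric g ×
     Σ (Vec (AndTerm n) (s n)) λ h →
       (x : Vec Bool n) → f n x ≡ g (Data.Vec.map (λ t → evalAnd t x) h))

toℚ : Bool → ℚ
toℚ true  = 1ℚ
toℚ false = 0ℚ

Δ : ∀ {n} → Vec Bool n → Vec ℚ n → ℚ
Δ x a = foldr _ _+ℚ_ 0ℚ (zipWith (λ b q → (toℚ b -ℚ q) *ℚ (toℚ b -ℚ q)) x a)

_⊆_ : ∀ {A : Set} → List A → List A → Set
xs ⊆ ys = ∀ {v} → v ∈ xs → v ∈ ys

KNNAccepts : ∀ {n} → List (Vec ℚ n) → List (Vec ℚ n) → ℕ → Vec Bool n → Set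
KNNAccepts P N k x =
  Σ (List _) λ AP → Σ (List _) λ AN →
    Unique AP × Unique AN × AP ⊆ P × AN ⊆ N ×
    length AP + length AN ≡ k × length AN ≤ length AP ×
    (∀ {a b} → a ∈ AP ++ AN → b ∈ P ++ N → b ∉ AP ++ AN → Δ x a < Δ x b)

record KNNRep (n : ℕ) (f : Vec Bool n → Bool) : Set where
  field
    P N      : List (Vec ℚ n)
    k        : ℕ
    k-pos    : 1 ≤ k
    uniqueP  : Unique P
    uniqueN  : Unique N
    disjoint : ∀ {v} → v ∈ P → v ∉ N
    correct  : (x : Vec Bool n) → (f x ≡ true → KNNAccepts P N k x)
                                 × (KNNAccepts P N k x → f x ≡ true)

kNN : BoolFamily → Set
kNN f = Σ ((n : ℕ) → KNNRep n (f n)) λ rep →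
          PolyBounded (λ n → length (KNNRep.P (rep n)) + length (KNNRep.N (rep n)))

-- Every AND term t gets two anchors, one of each label, at the centre of the subcube of inputs
-- satisfying t: coordinate ½ for an unconstrained variable, 3/2 or -½ for a positive or negative
-- literal.  Each coordinate then contributes exactly ¼ to the squared distance from an input
-- satisfying t, and some coordinate contributes at least 1 more when t is false.  Reference
-- anchors (½ ± ε, ½, …, ½) have squared distance n/4 ∓ ε + ε² according to the side of x₀, so
-- the ones shifted towards x₀ are always near while the others are ordered by ε.  The first
-- coordinate of every anchor is moved by a small ε(r), where the rank r differs for all anchors.
-- For an input satisfying w of the s terms, the 4s + 3 nearest anchors are both anchors of each
-- satisfied term, the 2(s + 1) reference anchors shifted towards x₀, and the 2(s - w) + 1
-- remaining reference anchors of lowest rank.  These last ones come in pairs of opposite labels,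
-- except the final one, which is labelled by the value of the symmetric gate at weight w; so the
-- positive anchors win exactly when the gate outputs 1.
module Submission where

open import Defs
open import Algebra.Bundles using (CommutativeMonoid)
import Algebra.Properties.CommutativeSemigroup as CommutativeSemigroupProperties
open import Data.Bool using (Bool; true; false; _∧_; _∨_; not; _xor_; T)
open import Data.Bool.Properties
  using (T-∧; T-≡; T?; ∧-identityʳ; ∧-zeroʳ; ∧-idem; ∧-inverseˡ; ∧-inverseʳ)
open import Data.Empty using (⊥-elim)
open import Data.Fin as Fin using (Fin)
import Data.Integer as ℤ
open import Data.List using (List; []; _∷_; length; _++_; map; filterᵇ; downFrom)
open import Data.List.Membership.Propositional using (_∈_; _∉_)
open import Data.List.Membership.Propositional.Properties
  using (∈-++⁺ˡ; ∈-++⁺ʳ; ∈-++⁻; ∈-map∘filter⁻; ∈-map∘filter⁺)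
import Data.List.Membership.DecPropositional as DecMembership
open import Data.List.Properties using (length-++; length-removeAt′; length-map; length-downFrom)
open import Data.List.Relation.Unary.All as All using (All; []; _∷_)
import Data.List.Relation.Unary.All.Properties as All
open import Data.List.Relation.Unary.AllPairs as AllPairs using (AllPairs; []; _∷_)
import Data.List.Relation.Unary.AllPairs.Properties as AllPairs
open import Data.List.Relation.Unary.Any using (here; there; index; _─_)
open import Data.List.Relation.Unary.Unique.Propositional using (Unique)
import Data.List.Relation.Unary.Unique.Propositional.Properties as Unique
open import Data.Nat as ℕ using (ℕ; zero; suc; _+_; _*_; _∸_; _^_; _≤_; _<_; z≤n; s≤s)
import Data.Nat.Properties as ℕ
open import Data.Nat.Tactic.RingSolver using (solve-∀)
open import Data.Product using (∃-syntax; _×_; _,_; proj₁; proj₂)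
open import Data.Rational as ℚ using (ℚ; 0ℚ; 1ℚ; ½; -½; _/_)
  renaming (_+_ to _+ℚ_; _-_ to _-ℚ_; _*_ to _*ℚ_; -_ to -ℚ_; _≤_ to _≤ℚ_; _<_ to _<ℚ_)
import Data.Rational.Properties as ℚ
open import Data.Rational.Solver using (module +-*-Solver)
open import Data.Sum using (inj₁; inj₂; [_,_]′)
open import Data.Unit using (⊤)
open import Data.Vec as Vec using (Vec; []; _∷_; lookup; tabulate)
import Data.Vec.Properties as Vec
open import Function using (_∘_; _⇔_; mk⇔; Equivalence)
open import Function.Construct.Composition using (_⇔-∘_)
open import Relation.Binary using (tri<; tri≈; tri>)
open import Relation.Binary.PropositionalEquality
  using (_≡_; _≢_; refl; sym; trans; cong; cong₂; subst; module ≡-Reasoning)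
open import Relation.Nullary using (¬_; yes; no)
open import Relation.Nullary.Decidable using (decidable-stable; True; toWitness)

open import Algebra.Properties.Group ℚ.+-0-group using (∙-cancelˡ)
open CommutativeSemigroupProperties (CommutativeMonoid.commutativeSemigroup ℚ.+-0-commutativeMonoid)
  using (x∙yz≈y∙xz; xy∙z≈xz∙y)

module _ {A : Set} where

  ∈-─ : ∀ {x z : A} {ys} (x∈ys : x ∈ ys) → z ∈ ys → z ≢ x → z ∈ (ys ─ x∈ys)
  ∈-─ (here refl)  (here refl)  z≢x = ⊥-elim (z≢x refl)
  ∈-─ (here refl)  (there z∈ys) _   = z∈ys
  ∈-─ (there x∈ys) (here refl)  _   = here refl
  ∈-─ (there x∈ys) (there z∈ys) z≢x = there (∈-─ x∈ys z∈ys z≢x)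

  unique-⊆⇒length-≤ : ∀ {xs ys : List A} → Unique xs → xs ⊆ ys → length xs ≤ length ys
  unique-⊆⇒length-≤ {[]}     _                   _        = z≤n
  unique-⊆⇒length-≤ {x ∷ xs} {ys} (x∉xs ∷ unique-xs) x∷xs⊆ys = begin
    suc (length xs)           ≤⟨ s≤s (unique-⊆⇒length-≤ unique-xs xs⊆ys─x) ⟩
    suc (length (ys ─ x∈ys))  ≡⟨ length-removeAt′ ys (index x∈ys) ⟨
    length ys                 ∎
    where
    open ℕ.≤-Reasoning
    x∈ys = x∷xs⊆ys (here refl)
    xs⊆ys─x : xs ⊆ (ys ─ x∈ys)
    xs⊆ys─x z∈xs = ∈-─ x∈ys (x∷xs⊆ys (there z∈xs)) (λ z≡x → All.lookup x∉xs z∈xs (sym z≡x))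

  AllPairs-≢-injective : ∀ {B : Set} (f : A → B) {xs a b} → AllPairs (λ a b → f a ≢ f b) xs →
                         a ∈ xs → b ∈ xs → f a ≡ f b → a ≡ b
  AllPairs-≢-injective f (_ ∷ _)   (here refl)  (here refl)  _     = refl
  AllPairs-≢-injective f (a≢ ∷ _)  (here refl)  (there b∈xs) fa≡fb = ⊥-elim (All.lookup a≢ b∈xs fa≡fb)
  AllPairs-≢-injective f (b≢ ∷ _)  (there a∈xs) (here refl)  fa≡fb = ⊥-elim (All.lookup b≢ a∈xs (sym fa≡fb))
  AllPairs-≢-injective f (_ ∷ ≢s) (there a∈xs) (there b∈xs) fa≡fb = AllPairs-≢-injective f ≢s a∈xs b∈xs fa≡fb

toℕ : Bool → ℕ
toℕ false = 0
toℕ true  = 1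

module _ {A : Set} (f : A → Bool) where

  count : List A → ℕ
  count []       = 0
  count (a ∷ xs) = toℕ (f a) + count xs

  length-filterᵇ : ∀ xs → length (filterᵇ f xs) ≡ count xs
  length-filterᵇ []       = refl
  length-filterᵇ (a ∷ xs) with f a
  ... | true  = cong suc (length-filterᵇ xs)
  ... | false = length-filterᵇ xs

  count-++ : ∀ xs ys → count (xs ++ ys) ≡ count xs + count ys
  count-++ []       ys = refl
  count-++ (a ∷ xs) ys = trans (cong (toℕ (f a) +_) (count-++ xs ys)) (sym (ℕ.+-assoc (toℕ (f a)) _ _))

count-+-count-not : ∀ {A : Set} (f : A → Bool) xs → count f xs + count (not ∘ f) xs ≡ length xs
count-+-count-not f []       = refl
count-+-count-not f (a ∷ xs) with f a
... | true  = cong suc (count-+-count-not f xs)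
... | false = trans (ℕ.+-suc (count f xs) _) (cong suc (count-+-count-not f xs))

infix 4 _==_

_==_ : Bool → Bool → Bool
b == true  = b
b == false = not b

==-refl : ∀ b → T (b == b)
==-refl true  = _
==-refl false = _

T-not : ∀ {b} → T b → ¬ T (not b)
T-not {true} _ ()

weight-∷ : ∀ {k} b (bs : Vec Bool k) → weight (b ∷ bs) ≡ toℕ b + weight bs
weight-∷ true  bs = refl
weight-∷ false bs = refl

weight-≤ : ∀ {k} (bs : Vec Bool k) → weight bs ≤ k
weight-≤ []           = z≤n
weight-≤ (true ∷ bs)  = s≤s (weight-≤ bs)
weight-≤ (false ∷ bs) = ℕ.m≤n⇒m≤1+n (weight-≤ bs)

canonical : (k w : ℕ) → Vec Bool k
canonical zero    _       = []
canonical (suc k) zero    = false ∷ canonical k zero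
canonical (suc k) (suc w) = true ∷ canonical k w

weight-canonical : ∀ k {w} → w ≤ k → weight (canonical k w) ≡ w
weight-canonical zero    z≤n       = refl
weight-canonical (suc k) z≤n       = weight-canonical k z≤n
weight-canonical (suc k) (s≤s w≤k) = cong suc (weight-canonical k w≤k)

-- Nearest sets

module _ {n} (x : Vec Bool n) (P N : List (Vec ℚ n)) where

  record IsNearest (AP AN : List (Vec ℚ n)) : Set where
    field
      unique-P : Unique AP
      unique-N : Unique AN
      ⊆-P      : AP ⊆ P
      ⊆-N      : AN ⊆ N
      closer   : ∀ {a b} → a ∈ AP ++ AN → b ∈ P ++ N → b ∉ AP ++ AN → Δ x a <ℚ Δ x b

module _ {n} {x : Vec Bool n} {P N : List (Vec ℚ n)} (disjoint : ∀ {v} → v ∈ P → v ∉ N) where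

  open IsNearest
  open DecMembership (Vec.≡-dec {n = n} ℚ._≟_) using (_∈?_)

  unique-++ : ∀ {AP AN} → IsNearest x P N AP AN → Unique (AP ++ AN)
  unique-++ A = Unique.++⁺ (unique-P A) (unique-N A) (λ (v∈AP , v∈AN) → disjoint (⊆-P A v∈AP) (⊆-N A v∈AN))

  ++-⊆ : ∀ {AP AN} → IsNearest x P N AP AN → (AP ++ AN) ⊆ (P ++ N)
  ++-⊆ {AP} A v∈A with ∈-++⁻ AP v∈A
  ... | inj₁ v∈AP = ∈-++⁺ˡ (⊆-P A v∈AP)
  ... | inj₂ v∈AN = ∈-++⁺ʳ P (⊆-N A v∈AN)

  nearest-⊆ : ∀ {AP AN BP BN} → IsNearest x P N AP AN → IsNearest x P N BP BN →
              length (AP ++ AN) ≡ length (BP ++ BN) → (AP ++ AN) ⊆ (BP ++ BN)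
  nearest-⊆ {AP} {AN} {BP} {BN} A B |A|≡|B| {a} a∈A =
    decidable-stable (a ∈? BP ++ BN) λ a∉B → ℕ.<-irrefl (sym |A|≡|B|) (|B|<|A| a∉B)
    where
    module _ (a∉B : a ∉ BP ++ BN) where
      B⊆A : (BP ++ BN) ⊆ (AP ++ AN)
      B⊆A {b} b∈B = decidable-stable (b ∈? AP ++ AN) λ b∉A →
        ℚ.<-asym (closer A a∈A (++-⊆ B b∈B) b∉A) (closer B b∈B (++-⊆ A a∈A) a∉B)
      a∷B⊆A : (a ∷ BP ++ BN) ⊆ (AP ++ AN)
      a∷B⊆A (here refl) = a∈A
      a∷B⊆A (there b∈B) = B⊆A b∈B
      a∉B′ : All (a ≢_) (BP ++ BN)
      a∉B′ = All.tabulate (λ b∈B a≡b → a∉B (subst (_∈ BP ++ BN) (sym a≡b) b∈B))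
      |B|<|A| : length (BP ++ BN) < length (AP ++ AN)
      |B|<|A| = unique-⊆⇒length-≤ (a∉B′ ∷ unique-++ B) a∷B⊆A

  nearest-majority : ∀ {AP AN BP BN} → IsNearest x P N AP AN → IsNearest x P N BP BN →
                     length AP + length AN ≡ length BP + length BN →
                     length BN ≤ length BP → length AN ≤ length AP
  nearest-majority {AP} {AN} {BP} {BN} A B |A|≡|B| |BN|≤|BP| = begin
    length AN  ≤⟨ |AN|≤|BN| ⟩
    length BN  ≤⟨ |BN|≤|BP| ⟩
    length BP  ≤⟨ ℕ.+-cancelʳ-≤ (length BN) (length BP) (length AP) |B|≤|AP|+|BN| ⟩
    length AP  ∎
    where
    open ℕ.≤-Reasoning
    A⊆B : (AP ++ AN) ⊆ (BP ++ BN)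
    A⊆B = nearest-⊆ A B (trans (length-++ AP) (trans |A|≡|B| (sym (length-++ BP))))
    AN⊆BN : AN ⊆ BN
    AN⊆BN a∈AN with ∈-++⁻ BP (A⊆B (∈-++⁺ʳ AP a∈AN))
    ... | inj₁ a∈BP = ⊥-elim (disjoint (⊆-P B a∈BP) (⊆-N A a∈AN))
    ... | inj₂ a∈BN = a∈BN
    |AN|≤|BN| : length AN ≤ length BN
    |AN|≤|BN| = unique-⊆⇒length-≤ (unique-N A) AN⊆BN
    |B|≤|AP|+|BN| : length BP + length BN ≤ length AP + length BN
    |B|≤|AP|+|BN| = ℕ.≤-trans (ℕ.≤-reflexive (sym |A|≡|B|)) (ℕ.+-monoʳ-≤ (length AP) |AN|≤|BN|)

  accepts⇔majority : ∀ {AP AN} → IsNearest x P N AP AN →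
                     KNNAccepts P N (length AP + length AN) x ⇔ length AN ≤ length AP
  accepts⇔majority A = mk⇔ to from
    where
    to : KNNAccepts P N _ x → _
    to (BP , BN , uBP , uBN , BP⊆P , BN⊆N , |B| , maj , closerB) = nearest-majority A
      (record { unique-P = uBP ; unique-N = uBN ; ⊆-P = BP⊆P ; ⊆-N = BN⊆N ; closer = closerB }) (sym |B|) maj
    from : _ → KNNAccepts P N _ x
    from maj = _ , _ , unique-P A , unique-N A , ⊆-P A , ⊆-N A , refl , maj , closer A

whole-isNearest : ∀ {n} {x : Vec Bool n} {P N} → Unique P → Unique N → IsNearest x P N P N
whole-isNearest unique-P unique-N = record
  { unique-P = unique-P
  ; unique-N = unique-N
  ; ⊆-P      = λ v∈P → v∈P
  ; ⊆-N      = λ v∈N → v∈N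
  ; closer   = λ _ b∈ b∉ → ⊥-elim (b∉ b∈)
  }

KNNRep-resp : ∀ {n} {f g : Vec Bool n → Bool} → (∀ x → f x ≡ g x) → KNNRep n f → KNNRep n g
KNNRep-resp f≗g rep = record
  { P = P ; N = N ; k = k ; k-pos = k-pos ; uniqueP = uniqueP ; uniqueN = uniqueN ; disjoint = disjoint
  ; correct = λ x → let (to , from) = correct x in to ∘ trans (f≗g x) , trans (sym (f≗g x)) ∘ from
  }
  where open KNNRep rep

-- Values allowed by an AND term

data Allowed : Set where
  both : Allowed
  only : Bool → Allowed
  none : Allowed

allows : Allowed → Bool → Bool
allows both         v = true
allows (only true)  v = v
allows (only false) v = not v
allows none         v = false

infixr 7 _∩_

_∩_ : Allowed → Allowed → Allowed
both       ∩ a          = a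
none       ∩ a          = none
only b     ∩ both       = only b
only b     ∩ none       = none
only true  ∩ only true  = only true
only false ∩ only false = only false
only true  ∩ only false = none
only false ∩ only true  = none

allows-∩ : ∀ a a′ v → allows (a ∩ a′) v ≡ allows a v ∧ allows a′ v
allows-∩ both         a′           v = refl
allows-∩ none         a′           v = refl
allows-∩ (only b)     both         v = sym (∧-identityʳ _)
allows-∩ (only b)     none         v = sym (∧-zeroʳ _)
allows-∩ (only true)  (only true)  v = sym (∧-idem v)
allows-∩ (only false) (only false) v = sym (∧-idem (not v))
allows-∩ (only true)  (only false) v = sym (∧-inverseʳ v)
allows-∩ (only false) (only true)  v = sym (∧-inverseˡ v)

T-allows-∩ : ∀ a a′ v → T (allows (a ∩ a′) v) ⇔ (T (allows a v) × T (allows a′ v))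
T-allows-∩ a a′ v rewrite allows-∩ a a′ v = T-∧

onlyAt : ∀ {n} → Fin n → Bool → Fin n → Allowed
onlyAt i b j with i Fin.≟ j
... | yes _ = only b
... | no  _ = both

onlyAt-self : ∀ {n} (i : Fin n) b → onlyAt i b i ≡ only b
onlyAt-self i b with i Fin.≟ i
... | yes _   = refl
... | no  i≢i = ⊥-elim (i≢i refl)

allowedBy : ∀ {n} → Lit n → Fin n → Allowed
allowedBy (pos i)     = onlyAt i true
allowedBy (neg i)     = onlyAt i false
allowedBy (cst true)  = λ _ → both
allowedBy (cst false) = λ _ → none

allowed : ∀ {n} → AndTerm n → Fin n → Allowed
allowed []      j = both
allowed (l ∷ t) j = allowedBy l j ∩ allowed t j

module _ {n} (x : Vec Bool n) where

  evalLit-allows : ∀ l j → T (evalLit l x) → T (allows (allowedBy l j) (lookup x j))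
  evalLit-allows (pos i) j xᵢ with i Fin.≟ j
  ... | yes refl = xᵢ
  ... | no  _    = _
  evalLit-allows (neg i) j ¬xᵢ with i Fin.≟ j
  ... | yes refl = ¬xᵢ
  ... | no  _    = _
  evalLit-allows (cst true) j _ = _

  evalAnd-allows : ∀ t → T (evalAnd t x) → ∀ j → T (allows (allowed t j) (lookup x j))
  evalAnd-allows []      _   j = _
  evalAnd-allows (l ∷ t) l∧t j = Equivalence.from (T-allows-∩ (allowedBy l j) (allowed t j) (lookup x j))
    (evalLit-allows l j (proj₁ (Equivalence.to T-∧ l∧t)) , evalAnd-allows t (proj₂ (Equivalence.to T-∧ l∧t)) j)

module _ {n} (x : Vec Bool (suc n)) where

  evalLit-forbids : ∀ l → ¬ T (evalLit l x) → ∃[ j ] ¬ T (allows (allowedBy l j) (lookup x j))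
  evalLit-forbids (pos i)     ¬xᵢ = i , subst (λ a → ¬ T (allows a (lookup x i))) (sym (onlyAt-self i true)) ¬xᵢ
  evalLit-forbids (neg i)     xᵢ  = i , subst (λ a → ¬ T (allows a (lookup x i))) (sym (onlyAt-self i false)) xᵢ
  evalLit-forbids (cst true)  ¬⊤  = ⊥-elim (¬⊤ _)
  evalLit-forbids (cst false) _   = Fin.zero , λ ()

  evalAnd-forbids : ∀ t → ¬ T (evalAnd t x) → ∃[ j ] ¬ T (allows (allowed t j) (lookup x j))
  evalAnd-forbids []      ¬⊤   = ⊥-elim (¬⊤ _)
  evalAnd-forbids (l ∷ t) ¬l∧t with T? (evalLit l x)
  ... | no ¬xₗ = let (j , ¬aⱼ) = evalLit-forbids l ¬xₗ in
                 j , ¬aⱼ ∘ proj₁ ∘ Equivalence.to (T-allows-∩ (allowedBy l j) (allowed t j) (lookup x j))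
  ... | yes xₗ = let (j , ¬aⱼ) = evalAnd-forbids t (¬l∧t ∘ Equivalence.from T-∧ ∘ (xₗ ,_)) in
                 j , ¬aⱼ ∘ proj₂ ∘ Equivalence.to (T-allows-∩ (allowedBy l j) (allowed t j) (lookup x j))

-- Squared distances to anchors

¼ ⅛ : ℚ
¼ = ℤ.+ 1 / 4
⅛ = ℤ.+ 1 / 8

sq : ℚ → ℚ
sq q = q *ℚ q

≤-decide : ∀ {p q} {p≤q : True (p ℚ.≤? q)} → p ≤ℚ q
≤-decide {p≤q = p≤q} = toWitness p≤q

<-decide : ∀ {p q} {p<q : True (p ℚ.<? q)} → p <ℚ q
<-decide {p<q = p<q} = toWitness p<q

p+r≡q⇒p≤q : ∀ {p q} r → 0ℚ ≤ℚ r → p +ℚ r ≡ q → p ≤ℚ q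
p+r≡q⇒p≤q {p} r 0≤r refl = ℚ.≤-trans (ℚ.≤-reflexive (sym (ℚ.+-identityʳ p))) (ℚ.+-monoʳ-≤ p 0≤r)

0≤sq : ∀ q → 0ℚ ≤ℚ sq q
0≤sq q = subst (_≤ℚ sq q) (ℚ.*-zeroˡ q) 0*q≤q*q
  where
  0*q≤q*q : 0ℚ *ℚ q ≤ℚ q *ℚ q
  0*q≤q*q with ℚ.≤-total 0ℚ q
  ... | inj₁ 0≤q = ℚ.*-monoʳ-≤-nonNeg q {{ℚ.nonNegative 0≤q}} 0≤q
  ... | inj₂ q≤0 = ℚ.*-monoʳ-≤-nonPos q {{ℚ.nonPositive q≤0}} q≤0

sq-mono-≤ : ∀ {p q} → 0ℚ ≤ℚ p → p ≤ℚ q → sq p ≤ℚ sq q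
sq-mono-≤ {p} {q} 0≤p p≤q = ℚ.≤-trans (ℚ.*-monoˡ-≤-nonNeg p {{ℚ.nonNegative 0≤p}} p≤q)
                                      (ℚ.*-monoʳ-≤-nonNeg q {{ℚ.nonNegative (ℚ.≤-trans 0≤p p≤q)}} p≤q)

sq-mono-< : ∀ {p q} → 0ℚ ≤ℚ p → p <ℚ q → sq p <ℚ sq q
sq-mono-< {p} {q} 0≤p p<q = ℚ.≤-<-trans (ℚ.*-monoˡ-≤-nonNeg p {{ℚ.nonNegative 0≤p}} (ℚ.<⇒≤ p<q))
                                        (ℚ.*-monoˡ-<-pos q {{ℚ.positive (ℚ.≤-<-trans 0≤p p<q)}} p<q)

1≤sq : ∀ {q} → 1ℚ ≤ℚ q → 1ℚ ≤ℚ sq q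
1≤sq = sq-mono-≤ ≤-decide

sq[½+δ]-mono-≤ : ∀ {δ δ′} → 0ℚ ≤ℚ δ → δ ≤ℚ δ′ → sq (½ +ℚ δ) ≤ℚ sq (½ +ℚ δ′)
sq[½+δ]-mono-≤ {δ} 0≤δ δ≤δ′ = sq-mono-≤ (ℚ.≤-trans (≤-decide {0ℚ} {½}) (p+r≡q⇒p≤q δ 0≤δ refl))
                                         (ℚ.+-monoʳ-≤ ½ δ≤δ′)

sq[½+δ]-mono-< : ∀ {δ δ′} → 0ℚ ≤ℚ δ → δ <ℚ δ′ → sq (½ +ℚ δ) <ℚ sq (½ +ℚ δ′)
sq[½+δ]-mono-< {δ} 0≤δ δ<δ′ = sq-mono-< (ℚ.≤-trans (≤-decide {0ℚ} {½}) (p+r≡q⇒p≤q δ 0≤δ refl))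
                                         (ℚ.+-monoʳ-< ½ δ<δ′)

sq[½-δ]≤sq[½] : ∀ {δ} → 0ℚ ≤ℚ δ → δ ≤ℚ 1ℚ → sq (½ -ℚ δ) ≤ℚ sq ½
sq[½-δ]≤sq[½] {δ} 0≤δ δ≤1 = p+r≡q⇒p≤q (δ *ℚ (1ℚ -ℚ δ)) 0≤δ[1-δ]
  (solve 1 (λ d → (con ½ :- d) :* (con ½ :- d) :+ d :* (con 1ℚ :- d) := con ½ :* con ½) refl δ)
  where
  open +-*-Solver
  0≤δ[1-δ] : 0ℚ ≤ℚ δ *ℚ (1ℚ -ℚ δ)
  0≤δ[1-δ] = subst (_≤ℚ δ *ℚ (1ℚ -ℚ δ)) (ℚ.*-zeroʳ δ) (ℚ.*-monoˡ-≤-nonNeg δ {{ℚ.nonNegative 0≤δ}}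
               (subst (_≤ℚ 1ℚ -ℚ δ) (ℚ.+-inverseʳ δ) (ℚ.+-monoˡ-≤ (-ℚ δ) δ≤1)))

sq[p-[c+δ]] : ∀ p c δ → sq (p -ℚ (c +ℚ δ)) ≡ sq ((p -ℚ c) -ℚ δ)
sq[p-[c+δ]] = solve 3 (λ p c d → (p :- (c :+ d)) :* (p :- (c :+ d)) := ((p :- c) :- d) :* ((p :- c) :- d)) refl
  where open +-*-Solver

sq[d-δ] : ∀ d δ → sq (d -ℚ δ) ≡ sq (-ℚ d +ℚ δ)
sq[d-δ] = solve 2 (λ d e → (d :- e) :* (d :- e) := (:- d :+ e) :* (:- d :+ e)) refl
  where open +-*-Solver

-- Allowed bits lie at distance ½ from the centre, forbidden ones at distance at least 3/2.
centre : Allowed → ℚ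
centre both         = ½
centre (only true)  = ℤ.+ 3 / 2
centre (only false) = -½
centre none         = ℤ.+ 5 / 2

sq-centre-allowed : ∀ a v → T (allows a v) → sq (toℚ v -ℚ centre a) ≡ sq (toℚ v -ℚ ½)
sq-centre-allowed both         v     _ = refl
sq-centre-allowed (only true)  true  _ = refl
sq-centre-allowed (only false) false _ = refl

sq-½≤sq-centre : ∀ a v → sq (toℚ v -ℚ ½) ≤ℚ sq (toℚ v -ℚ centre a)
sq-½≤sq-centre both         v     = ℚ.≤-refl
sq-½≤sq-centre (only true)  true  = ≤-decide
sq-½≤sq-centre (only true)  false = ≤-decide
sq-½≤sq-centre (only false) true  = ≤-decide
sq-½≤sq-centre (only false) false = ≤-decide
sq-½≤sq-centre none         true  = ≤-decide
sq-½≤sq-centre none         false = ≤-decide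

sq-centre-forbidden : ∀ a v → ¬ T (allows a v) → 1ℚ +ℚ sq (toℚ v -ℚ ½) ≤ℚ sq (toℚ v -ℚ centre a)
sq-centre-forbidden both         v     ¬⊤ = ⊥-elim (¬⊤ _)
sq-centre-forbidden (only true)  true  ¬⊤ = ⊥-elim (¬⊤ _)
sq-centre-forbidden (only true)  false _  = ≤-decide
sq-centre-forbidden (only false) true  _  = ≤-decide
sq-centre-forbidden (only false) false ¬⊤ = ⊥-elim (¬⊤ _)
sq-centre-forbidden none         true  _  = ≤-decide
sq-centre-forbidden none         false _  = ≤-decide

module _ {δ} (0≤δ : 0ℚ ≤ℚ δ) (δ≤¼ : δ ≤ℚ ¼) where

  sq-shifted-centre-allowed : ∀ a v → T (allows a v) → sq (toℚ v -ℚ (centre a +ℚ δ)) ≤ℚ sq (½ +ℚ δ)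
  sq-shifted-centre-allowed a v a∋v =
    ℚ.≤-trans (ℚ.≤-reflexive (sq[p-[c+δ]] (toℚ v) (centre a) δ)) (bound a v a∋v)
    where
    sq[½-δ]≤sq[½+δ] : sq (½ -ℚ δ) ≤ℚ sq (½ +ℚ δ)
    sq[½-δ]≤sq[½+δ] = ℚ.≤-trans (sq[½-δ]≤sq[½] 0≤δ (ℚ.≤-trans δ≤¼ ≤-decide)) (sq[½+δ]-mono-≤ ℚ.≤-refl 0≤δ)
    bound : ∀ a v → T (allows a v) → sq ((toℚ v -ℚ centre a) -ℚ δ) ≤ℚ sq (½ +ℚ δ)
    bound both         true  _ = sq[½-δ]≤sq[½+δ]
    bound both         false _ = ℚ.≤-reflexive (sq[d-δ] -½ δ)
    bound (only true)  true  _ = ℚ.≤-reflexive (sq[d-δ] -½ δ)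
    bound (only false) false _ = sq[½-δ]≤sq[½+δ]

  sq-shifted-centre-forbidden : ∀ a v → ¬ T (allows a v) → 1ℚ ≤ℚ sq (toℚ v -ℚ (centre a +ℚ δ))
  sq-shifted-centre-forbidden a v a∌v =
    ℚ.≤-trans (bound a v a∌v) (ℚ.≤-reflexive (sym (sq[p-[c+δ]] (toℚ v) (centre a) δ)))
    where
    1≤sq[d-δ] : ∀ d → 1ℚ ≤ℚ -ℚ d → 1ℚ ≤ℚ sq (d -ℚ δ)
    1≤sq[d-δ] d 1≤-d = ℚ.≤-trans (1≤sq (ℚ.≤-trans 1≤-d (p+r≡q⇒p≤q δ 0≤δ refl)))
                                 (ℚ.≤-reflexive (sym (sq[d-δ] d δ)))
    bound : ∀ a v → ¬ T (allows a v) → 1ℚ ≤ℚ sq ((toℚ v -ℚ centre a) -ℚ δ)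
    bound both         v     ¬⊤ = ⊥-elim (¬⊤ _)
    bound (only true)  true  ¬⊤ = ⊥-elim (¬⊤ _)
    bound (only false) false ¬⊤ = ⊥-elim (¬⊤ _)
    bound (only true)  false _  = 1≤sq[d-δ] (toℚ false -ℚ centre (only true)) ≤-decide
    bound none         true  _  = 1≤sq[d-δ] (toℚ true -ℚ centre none) ≤-decide
    bound none         false _  = 1≤sq[d-δ] (toℚ false -ℚ centre none) ≤-decide
    bound (only false) true  _  =
      1≤sq (ℚ.≤-trans (≤-decide {p≤q = _}) (ℚ.+-monoʳ-≤ (ℤ.+ 3 / 2) (ℚ.neg-antimono-≤ δ≤¼)))

centres : ∀ {m} → (Fin m → Allowed) → Vec ℚ m
centres f = tabulate (centre ∘ f)

½s : ∀ {m} → Vec ℚ m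
½s = centres (λ _ → both)

Δ-centres-allowed : ∀ {m} (y : Vec Bool m) (f : Fin m → Allowed) →
                    (∀ j → T (allows (f j) (lookup y j))) → Δ y (centres f) ≡ Δ y ½s
Δ-centres-allowed []      f _   = refl
Δ-centres-allowed (v ∷ y) f y∈f = cong₂ _+ℚ_ (sq-centre-allowed (f Fin.zero) v (y∈f Fin.zero))
                                             (Δ-centres-allowed y (f ∘ Fin.suc) (y∈f ∘ Fin.suc))

Δ-½s-≤ : ∀ {m} (y : Vec Bool m) (f : Fin m → Allowed) → Δ y ½s ≤ℚ Δ y (centres f)
Δ-½s-≤ []      f = ℚ.≤-refl
Δ-½s-≤ (v ∷ y) f = ℚ.+-mono-≤ (sq-½≤sq-centre (f Fin.zero) v) (Δ-½s-≤ y (f ∘ Fin.suc))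

Δ-centres-forbidden : ∀ {m} (y : Vec Bool m) (f : Fin m → Allowed) (j : Fin m) →
                      ¬ T (allows (f j) (lookup y j)) → 1ℚ +ℚ Δ y ½s ≤ℚ Δ y (centres f)
Δ-centres-forbidden (v ∷ y) f Fin.zero    f∌v = ℚ.≤-trans
  (ℚ.≤-reflexive (sym (ℚ.+-assoc 1ℚ (sq (toℚ v -ℚ ½)) (Δ y ½s))))
  (ℚ.+-mono-≤ (sq-centre-forbidden (f Fin.zero) v f∌v) (Δ-½s-≤ y (f ∘ Fin.suc)))
Δ-centres-forbidden (v ∷ y) f (Fin.suc j) f∌y = ℚ.≤-trans
  (ℚ.≤-reflexive (x∙yz≈y∙xz 1ℚ (sq (toℚ v -ℚ ½)) (Δ y ½s)))
  (ℚ.+-mono-≤ (sq-½≤sq-centre (f Fin.zero) v) (Δ-centres-forbidden y (f ∘ Fin.suc) j f∌y))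

termAnchor : ∀ {n} → (Fin (suc n) → Allowed) → ℚ → Vec ℚ (suc n)
termAnchor f δ = (centre (f Fin.zero) +ℚ δ) ∷ centres (f ∘ Fin.suc)

refHead : Bool → ℚ → ℚ
refHead true  δ = ½ +ℚ δ
refHead false δ = ½ -ℚ δ

refAnchor : ∀ {n} → Bool → ℚ → Vec ℚ (suc n)
refAnchor σ δ = refHead σ δ ∷ ½s

module _ {n} (v : Bool) (y : Vec Bool n) {δ} (0≤δ : 0ℚ ≤ℚ δ) (δ≤¼ : δ ≤ℚ ¼) where

  Δ-termAnchor-allowed : ∀ f → (∀ j → T (allows (f j) (lookup (v ∷ y) j))) →
                         Δ (v ∷ y) (termAnchor f δ) ≤ℚ sq (½ +ℚ δ) +ℚ Δ y ½s
  Δ-termAnchor-allowed f v∷y∈f = ℚ.+-mono-≤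
    (sq-shifted-centre-allowed 0≤δ δ≤¼ (f Fin.zero) v (v∷y∈f Fin.zero))
    (ℚ.≤-reflexive (Δ-centres-allowed y (f ∘ Fin.suc) (v∷y∈f ∘ Fin.suc)))

  Δ-termAnchor-forbidden : ∀ f j → ¬ T (allows (f j) (lookup (v ∷ y) j)) →
                           1ℚ +ℚ Δ y ½s ≤ℚ Δ (v ∷ y) (termAnchor f δ)
  Δ-termAnchor-forbidden f Fin.zero    f∌v =
    ℚ.+-mono-≤ (sq-shifted-centre-forbidden 0≤δ δ≤¼ (f Fin.zero) v f∌v) (Δ-½s-≤ y (f ∘ Fin.suc))
  Δ-termAnchor-forbidden f (Fin.suc j) f∌y = ℚ.≤-trans
    (ℚ.≤-reflexive (sym (ℚ.+-identityˡ _)))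
    (ℚ.+-mono-≤ (0≤sq (toℚ v -ℚ (centre (f Fin.zero) +ℚ δ))) (Δ-centres-forbidden y (f ∘ Fin.suc) j f∌y))

Δ-refAnchor-toward : ∀ {n} σ (y : Vec Bool n) {δ δ′} → 0ℚ ≤ℚ δ → δ ≤ℚ 1ℚ → 0ℚ ≤ℚ δ′ →
                     Δ (σ ∷ y) (refAnchor σ δ) ≤ℚ sq (½ +ℚ δ′) +ℚ Δ y ½s
Δ-refAnchor-toward σ y {δ} {δ′} 0≤δ δ≤1 0≤δ′ = ℚ.+-monoˡ-≤ (Δ y ½s) (begin
  sq (toℚ σ -ℚ refHead σ δ)  ≡⟨ sq-toward σ ⟩
  sq (½ -ℚ δ)                ≤⟨ sq[½-δ]≤sq[½] 0≤δ δ≤1 ⟩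
  sq (½ +ℚ 0ℚ)               ≤⟨ sq[½+δ]-mono-≤ ℚ.≤-refl 0≤δ′ ⟩
  sq (½ +ℚ δ′)               ∎)
  where
  open ℚ.≤-Reasoning
  sq-toward : ∀ σ → sq (toℚ σ -ℚ refHead σ δ) ≡ sq (½ -ℚ δ)
  sq-toward true  = sq[p-[c+δ]] 1ℚ ½ δ
  sq-toward false = trans (sq[p-[c+δ]] 0ℚ ½ (-ℚ δ)) (sq[d-δ] -½ (-ℚ δ))

Δ-refAnchor-away : ∀ {n} σ (y : Vec Bool n) δ → Δ (not σ ∷ y) (refAnchor σ δ) ≡ sq (½ +ℚ δ) +ℚ Δ y ½s
Δ-refAnchor-away σ y δ = cong (_+ℚ Δ y ½s) (sq-away σ)
  where
  open +-*-Solver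
  sq-away : ∀ σ → sq (toℚ (not σ) -ℚ refHead σ δ) ≡ sq (½ +ℚ δ)
  sq-away true  = trans (sq[p-[c+δ]] 0ℚ ½ δ) (sq[d-δ] -½ δ)
  sq-away false = solve 1 (λ d → (con 1ℚ :- (con ½ :- d)) :* (con 1ℚ :- (con ½ :- d)) :=
                                 (con ½ :+ d) :* (con ½ :+ d)) refl δ

-- Perturbations

halving : ℕ → ℚ
halving zero    = ⅛
halving (suc r) = ½ *ℚ halving r

0<halving : ∀ r → 0ℚ <ℚ halving r
0<halving zero    = <-decide
0<halving (suc r) = subst (_<ℚ ½ *ℚ halving r) (ℚ.*-zeroʳ ½) (ℚ.*-monoʳ-<-pos ½ (0<halving r))

halving-suc-< : ∀ r → halving (suc r) <ℚ halving r
halving-suc-< r = subst (½ *ℚ halving r <ℚ_) (ℚ.*-identityˡ (halving r))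
  (ℚ.*-monoˡ-<-pos (halving r) {{ℚ.positive (0<halving r)}} (<-decide {½} {1ℚ}))

halving-antimono-≤ : ∀ {r r′} → r ≤ r′ → halving r′ ≤ℚ halving r
halving-antimono-≤ = go ∘ ℕ.≤⇒≤′
  where
  go : ∀ {r r′} → r ℕ.≤′ r′ → halving r′ ≤ℚ halving r
  go ℕ.≤′-refl              = ℚ.≤-refl
  go (ℕ.≤′-step {r′} r≤r′) = ℚ.≤-trans (ℚ.<⇒≤ (halving-suc-< r′)) (go r≤r′)

halving-antimono-< : ∀ {r r′} → r < r′ → halving r′ <ℚ halving r
halving-antimono-< {r} r<r′ = ℚ.≤-<-trans (halving-antimono-≤ r<r′) (halving-suc-< r)

ε : ℕ → ℚ
ε r = ¼ -ℚ halving r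

ε-mono-< : ∀ {r r′} → r < r′ → ε r <ℚ ε r′
ε-mono-< r<r′ = ℚ.+-monoʳ-< ¼ (ℚ.neg-antimono-< (halving-antimono-< r<r′))

ε-mono-≤ : ∀ {r r′} → r ≤ r′ → ε r ≤ℚ ε r′
ε-mono-≤ r≤r′ = ℚ.+-monoʳ-≤ ¼ (ℚ.neg-antimono-≤ (halving-antimono-≤ r≤r′))

ε-injective : ∀ {r r′} → ε r ≡ ε r′ → r ≡ r′
ε-injective {r} {r′} εr≡εr′ with ℕ.<-cmp r r′
... | tri< r<r′ _ _ = ⊥-elim (ℚ.<⇒≢ (ε-mono-< r<r′) εr≡εr′)
... | tri≈ _ r≡r′ _ = r≡r′
... | tri> _ _ r′<r = ⊥-elim (ℚ.<⇒≢ (ε-mono-< r′<r) (sym εr≡εr′))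

0<ε : ∀ r → 0ℚ <ℚ ε r
0<ε r = ℚ.<-≤-trans (<-decide {0ℚ} {ε 0}) (ε-mono-≤ (z≤n {r}))

ε<¼ : ∀ r → ε r <ℚ ¼
ε<¼ r = ℚ.+-monoʳ-< ¼ (ℚ.neg-antimono-< (0<halving r))

0≤ε : ∀ r → 0ℚ ≤ℚ ε r
0≤ε r = ℚ.<⇒≤ (0<ε r)

ε≤¼ : ∀ r → ε r ≤ℚ ¼
ε≤¼ r = ℚ.<⇒≤ (ε<¼ r)

ε≤1 : ∀ r → ε r ≤ℚ 1ℚ
ε≤1 r = ℚ.≤-trans (ε≤¼ r) ≤-decide

sq[½+ε]≤1 : ∀ r → sq (½ +ℚ ε r) ≤ℚ 1ℚ
sq[½+ε]≤1 r = ℚ.≤-trans (sq[½+δ]-mono-≤ (0≤ε r) (ε≤¼ r)) ≤-decide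

fromℕ : ℕ → ℚ
fromℕ zero    = 0ℚ
fromℕ (suc k) = 1ℚ +ℚ fromℕ k

fromℕ-mono-≤ : ∀ {k k′} → k ≤ k′ → fromℕ k ≤ℚ fromℕ k′
fromℕ-mono-≤ {k′ = k′} z≤n = 0≤fromℕ k′
  where
  0≤fromℕ : ∀ k → 0ℚ ≤ℚ fromℕ k
  0≤fromℕ zero    = ℚ.≤-refl
  0≤fromℕ (suc k) = ℚ.≤-trans (0≤fromℕ k) (p+r≡q⇒p≤q 1ℚ ≤-decide (ℚ.+-comm (fromℕ k) 1ℚ))
fromℕ-mono-≤ (s≤s k≤k′) = ℚ.+-monoʳ-≤ 1ℚ (fromℕ-mono-≤ k≤k′)

fromℕ-+-fraction-< : ∀ {k k′ p p′} → k < k′ → p <ℚ 1ℚ → 0ℚ ≤ℚ p′ → fromℕ k +ℚ p <ℚ fromℕ k′ +ℚ p′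
fromℕ-+-fraction-< {k} {k′} {p} {p′} k<k′ p<1 0≤p′ = begin-strict
  fromℕ k +ℚ p    <⟨ ℚ.+-monoʳ-< (fromℕ k) p<1 ⟩
  fromℕ k +ℚ 1ℚ   ≡⟨ ℚ.+-comm (fromℕ k) 1ℚ ⟩
  fromℕ (suc k)   ≤⟨ fromℕ-mono-≤ k<k′ ⟩
  fromℕ k′        ≤⟨ p+r≡q⇒p≤q p′ 0≤p′ refl ⟩
  fromℕ k′ +ℚ p′  ∎
  where open ℚ.≤-Reasoning

fromℕ-+-fraction-injective : ∀ {k k′ p p′} → 0ℚ ≤ℚ p → p <ℚ 1ℚ → 0ℚ ≤ℚ p′ → p′ <ℚ 1ℚ →
                             fromℕ k +ℚ p ≡ fromℕ k′ +ℚ p′ → k ≡ k′ × p ≡ p′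
fromℕ-+-fraction-injective {k} {k′} {p} {p′} 0≤p p<1 0≤p′ p′<1 eq with ℕ.<-cmp k k′
... | tri< k<k′ _ _ = ⊥-elim (ℚ.<⇒≢ (fromℕ-+-fraction-< k<k′ p<1 0≤p′) eq)
... | tri> _ _ k′<k = ⊥-elim (ℚ.<⇒≢ (fromℕ-+-fraction-< k′<k p′<1 0≤p) (sym eq))
... | tri≈ _ refl _ = refl , ∙-cancelˡ (fromℕ k) p p′ eq

level : Allowed → ℕ
level both         = 1
level (only true)  = 2
level (only false) = 0
level none         = 3

shifted-centre-+-½ : ∀ a e → (centre a +ℚ e) +ℚ ½ ≡ fromℕ (level a) +ℚ e
shifted-centre-+-½ a e = trans (xy∙z≈xz∙y (centre a) e ½) (cong (_+ℚ e) (centre-+-½ a))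
  where
  centre-+-½ : ∀ a → centre a +ℚ ½ ≡ fromℕ (level a)
  centre-+-½ both         = refl
  centre-+-½ (only true)  = refl
  centre-+-½ (only false) = refl
  centre-+-½ none         = refl

fraction : Bool → ℕ → ℚ
fraction true  r = ε r
fraction false r = 1ℚ -ℚ ε r

0≤fraction : ∀ b r → 0ℚ ≤ℚ fraction b r
0≤fraction true  r = 0≤ε r
0≤fraction false r = subst (_≤ℚ 1ℚ -ℚ ε r) (ℚ.+-inverseʳ (ε r)) (ℚ.+-monoˡ-≤ (-ℚ ε r) (ε≤1 r))

fraction<1 : ∀ b r → fraction b r <ℚ 1ℚ
fraction<1 true  r = ℚ.<-trans (ε<¼ r) <-decide
fraction<1 false r = ℚ.+-monoʳ-< 1ℚ (ℚ.neg-antimono-< (0<ε r))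

fraction-injective : ∀ b b′ {r r′} → fraction b r ≡ fraction b′ r′ → r ≡ r′
fraction-injective true  true  eq = ε-injective eq
fraction-injective false false {r} {r′} eq = ε-injective (ℚ.neg-injective (∙-cancelˡ 1ℚ (-ℚ ε r) (-ℚ ε r′) eq))
fraction-injective true  false {r} {r′} eq = ⊥-elim (ℚ.<⇒≢ ε<1-ε eq)
  where
  ε<1-ε : ε r <ℚ 1ℚ -ℚ ε r′
  ε<1-ε = ℚ.<-trans (ε<¼ r) (ℚ.<-≤-trans <-decide (ℚ.+-monoʳ-≤ 1ℚ (ℚ.neg-antimono-≤ (ε≤¼ r′))))
fraction-injective false true  eq = sym (fraction-injective true false (sym eq))

toℕ+2*-≤ : ∀ c {i k} → i < k → toℕ c + 2 * i ≤ 2 * k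
toℕ+2*-≤ c {i} {k} i<k = begin
  toℕ c + 2 * i  ≤⟨ ℕ.+-monoˡ-≤ (2 * i) (toℕ≤1 c) ⟩
  suc (2 * i)    ≤⟨ ℕ.n≤1+n _ ⟩
  2 + 2 * i      ≡⟨ ℕ.*-suc 2 i ⟨
  2 * suc i      ≤⟨ ℕ.*-monoʳ-≤ 2 i<k ⟩
  2 * k          ∎
  where
  open ℕ.≤-Reasoning
  toℕ≤1 : ∀ b → toℕ b ≤ 1
  toℕ≤1 true  = ℕ.≤-refl
  toℕ≤1 false = z≤n

count-pair-both : ∀ p g {a₁ a₂} r → a₁ ≡ true → a₂ ≡ true →
                  toℕ (a₁ ∧ (not g == p)) + (toℕ (a₂ ∧ (g == p)) + r) ≡ suc r
count-pair-both true  true  r refl refl = refl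
count-pair-both true  false r refl refl = refl
count-pair-both false true  r refl refl = refl
count-pair-both false false r refl refl = refl

count-pair-second : ∀ p g {a₁ a₂} r → a₁ ≡ false → a₂ ≡ true →
                    toℕ (a₁ ∧ (not g == p)) + (toℕ (a₂ ∧ (g == p)) + r) ≡ toℕ (g == p) + r
count-pair-second p g r refl refl = refl

count-pair-none : ∀ p g {a₁ a₂} r → a₁ ≡ false → a₂ ≡ false →
                  toℕ (a₁ ∧ (not g == p)) + (toℕ (a₂ ∧ (g == p)) + r) ≡ r
count-pair-none p g r refl refl = refl

count-pair-term : ∀ p e r → toℕ (e ∧ (true == p)) + (toℕ (e ∧ (false == p)) + r) ≡ toℕ e + r
count-pair-term true  true  r = refl
count-pair-term true  false r = refl
count-pair-term false true  r = refl
count-pair-term false false r = refl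

-- The construction

module Construction {n s : ℕ} (h : Vec (AndTerm (suc n)) s) (G : ℕ → Bool) where

  -- term t i c: the anchor with label c of the term t, the i-th from the end of h.
  -- ref b j c: a reference anchor with first coordinate ½ + ε or ½ - ε according to b.
  data Spec : Set where
    term : AndTerm (suc n) → ℕ → Bool → Spec
    ref  : Bool → ℕ → Bool → Spec

  refBase : Bool → ℕ
  refBase true  = 2 * s
  refBase false = 2 * suc s + refBase true

  rank : Spec → ℕ
  rank (term _ i c) = toℕ c + 2 * i
  rank (ref b j c)  = toℕ c + 2 * j + refBase b

  label : Spec → Bool
  label (term _ _ c) = c
  label (ref _ j c)  = c xor G (s ∸ j)

  anchor : Spec → Vec ℚ (suc n)
  anchor σ@(term t _ _) = termAnchor (allowed t) (ε (rank σ))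
  anchor σ@(ref b _ _)  = refAnchor b (ε (rank σ))

  termSpecs : ∀ {k} → Vec (AndTerm (suc n)) k → List Spec
  termSpecs []               = []
  termSpecs {suc k} (t ∷ ts) = term t k true ∷ term t k false ∷ termSpecs ts

  refSpecs : Bool → ℕ → List Spec
  refSpecs b zero    = []
  refSpecs b (suc j) = ref b j true ∷ ref b j false ∷ refSpecs b j

  specs : List Spec
  specs = refSpecs false (suc s) ++ refSpecs true (suc s) ++ termSpecs h

  ranks-termSpecs : ∀ {k} (ts : Vec (AndTerm (suc n)) k) → map rank (termSpecs ts) ≡ downFrom (2 * k)
  ranks-termSpecs []               = refl
  ranks-termSpecs {suc k} (t ∷ ts) = trans (cong (λ rs → suc (2 * k) ∷ 2 * k ∷ rs) (ranks-termSpecs ts))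
                                           (cong downFrom (sym (ℕ.*-suc 2 k)))

  ranks-refSpecs : ∀ b J {rest} → map rank rest ≡ downFrom (refBase b) →
                   map rank (refSpecs b J ++ rest) ≡ downFrom (2 * J + refBase b)
  ranks-refSpecs b zero    ranks-rest = ranks-rest
  ranks-refSpecs b (suc J) ranks-rest = trans
    (cong (λ rs → suc (2 * J + refBase b) ∷ 2 * J + refBase b ∷ rs) (ranks-refSpecs b J ranks-rest))
    (cong (λ k → downFrom (k + refBase b)) (sym (ℕ.*-suc 2 J)))

  ranks-specs : map rank specs ≡ downFrom (2 * suc s + refBase false)
  ranks-specs = ranks-refSpecs false (suc s) (ranks-refSpecs true (suc s) (ranks-termSpecs h))

  ranks-distinct : AllPairs (λ σ τ → rank σ ≢ rank τ) specs
  ranks-distinct = AllPairs.map⁻ (subst Unique (sym ranks-specs) (Unique.downFrom⁺ _))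

  side : Spec → Bool
  side (ref false _ _) = false
  side _               = true

  headLevel : Spec → ℕ
  headLevel (term t _ _)    = level (allowed t Fin.zero)
  headLevel (ref true _ _)  = 1
  headLevel (ref false _ _) = 0

  head-anchor : ∀ σ → Vec.head (anchor σ) +ℚ ½ ≡ fromℕ (headLevel σ) +ℚ fraction (side σ) (rank σ)
  head-anchor σ@(term t _ _)    = shifted-centre-+-½ (allowed t Fin.zero) (ε (rank σ))
  head-anchor σ@(ref true _ _)  = shifted-centre-+-½ both (ε (rank σ))
  head-anchor σ@(ref false _ _) =
    solve 1 (λ e → (con ½ :- e) :+ con ½ := con 0ℚ :+ (con 1ℚ :- e)) refl (ε (rank σ))
    where open +-*-Solver

  -- The first coordinate plus ½ splits into an integer and a fraction in [0, 1) determining the rank.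
  anchor-injective : ∀ σ τ → anchor σ ≡ anchor τ → rank σ ≡ rank τ
  anchor-injective σ τ eq = fraction-injective (side σ) (side τ) (proj₂ (fromℕ-+-fraction-injective
    {headLevel σ} {headLevel τ}
    (0≤fraction (side σ) (rank σ)) (fraction<1 (side σ) (rank σ))
    (0≤fraction (side τ) (rank τ)) (fraction<1 (side τ) (rank τ))
    (trans (sym (head-anchor σ)) (trans (cong (λ a → Vec.head a +ℚ ½) eq) (head-anchor τ)))))

  anchors-distinct : AllPairs (λ σ τ → anchor σ ≢ anchor τ) specs
  anchors-distinct = AllPairs.map (λ {σ} {τ} r≢ a≡ → r≢ (anchor-injective σ τ a≡)) ranks-distinct

  weightAt : Vec Bool (suc n) → ℕ
  weightAt x = weight (Vec.map (λ t → evalAnd t x) h)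

  missing : Vec Bool (suc n) → ℕ
  missing x = s ∸ weightAt x

  missing<1+s : ∀ x → missing x < suc s
  missing<1+s x = s≤s (ℕ.m∸n≤m s (weightAt x))

  threshold : Vec Bool (suc n) → ℕ
  threshold (v ∷ y) = 2 * missing (v ∷ y) + refBase (not v)

  -- For a reference anchor shifted away from x₀ the second test says rank ≤ threshold x.
  near : Vec Bool (suc n) → Spec → Bool
  near x       (term t _ _) = evalAnd t x
  near (v ∷ y) (ref b j c)  = (b == v) ∨ (toℕ c + 2 * j ℕ.≤ᵇ 2 * missing (v ∷ y))

  IndexBounded : Spec → Set
  IndexBounded (term _ i _) = i < s
  IndexBounded (ref _ _ _)  = ⊤

  termSpecs-indexBounded : ∀ {k} (ts : Vec (AndTerm (suc n)) k) → k ≤ s → All IndexBounded (termSpecs ts)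
  termSpecs-indexBounded []       _   = []
  termSpecs-indexBounded (t ∷ ts) k<s = k<s ∷ k<s ∷ termSpecs-indexBounded ts (ℕ.<⇒≤ k<s)

  refSpecs-indexBounded : ∀ b J → All IndexBounded (refSpecs b J)
  refSpecs-indexBounded b zero    = []
  refSpecs-indexBounded b (suc J) = _ ∷ _ ∷ refSpecs-indexBounded b J

  specs-indexBounded : All IndexBounded specs
  specs-indexBounded = All.++⁺ (refSpecs-indexBounded false (suc s))
    (All.++⁺ (refSpecs-indexBounded true (suc s)) (termSpecs-indexBounded h ℕ.≤-refl))

  term-rank≤threshold : ∀ t {i} c x → i < s → rank (term t i c) ≤ threshold x
  term-rank≤threshold t {i} c (v ∷ y) i<s = begin
    toℕ c + 2 * i                          ≤⟨ toℕ+2*-≤ c i<s ⟩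
    refBase true                           ≤⟨ refBase-true-≤ (not v) ⟩
    refBase (not v)                        ≤⟨ ℕ.m≤n+m _ _ ⟩
    2 * missing (v ∷ y) + refBase (not v)  ∎
    where
    open ℕ.≤-Reasoning
    refBase-true-≤ : ∀ b → refBase true ≤ refBase b
    refBase-true-≤ true  = ℕ.≤-refl
    refBase-true-≤ false = ℕ.m≤n+m (refBase true) (2 * suc s)

  module _ (b : Bool) (y : Vec Bool n) (j : ℕ) (c : Bool) where

    private
      m = missing (not b ∷ y)
      r = rank (ref b j c)

    Δ-away-admitted : T (toℕ c + 2 * j ℕ.≤ᵇ 2 * m) →
                      Δ (not b ∷ y) (anchor (ref b j c)) ≤ℚ sq (½ +ℚ ε (2 * m + refBase b)) +ℚ Δ y ½s
    Δ-away-admitted admitted = ℚ.≤-trans (ℚ.≤-reflexive (Δ-refAnchor-away b y (ε r)))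
      (ℚ.+-monoˡ-≤ (Δ y ½s) (sq[½+δ]-mono-≤ (0≤ε r) (ε-mono-≤ r≤θ)))
      where
      r≤θ : r ≤ 2 * m + refBase b
      r≤θ = ℕ.+-monoˡ-≤ (refBase b) (ℕ.≤ᵇ⇒≤ (toℕ c + 2 * j) (2 * m) admitted)

    Δ-away-rejected : ¬ T (toℕ c + 2 * j ℕ.≤ᵇ 2 * m) →
                      sq (½ +ℚ ε (suc (2 * m + refBase b))) +ℚ Δ y ½s ≤ℚ Δ (not b ∷ y) (anchor (ref b j c))
    Δ-away-rejected rejected = ℚ.≤-trans
      (ℚ.+-monoˡ-≤ (Δ y ½s) (sq[½+δ]-mono-≤ (0≤ε (suc (2 * m + refBase b))) (ε-mono-≤ θ<r)))
      (ℚ.≤-reflexive (sym (Δ-refAnchor-away b y (ε r))))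
      where
      θ<r : 2 * m + refBase b < r
      θ<r = ℕ.+-monoˡ-≤ (refBase b) (ℕ.≰⇒> (rejected ∘ ℕ.≤⇒≤ᵇ))

  near-bound : ∀ v y σ → IndexBounded σ → T (near (v ∷ y) σ) →
               Δ (v ∷ y) (anchor σ) ≤ℚ sq (½ +ℚ ε (threshold (v ∷ y))) +ℚ Δ y ½s
  near-bound v y σ@(term t i c) i<s satisfied = ℚ.≤-trans
    (Δ-termAnchor-allowed v y (0≤ε (rank σ)) (ε≤¼ (rank σ)) (allowed t) (evalAnd-allows (v ∷ y) t satisfied))
    (ℚ.+-monoˡ-≤ (Δ y ½s) (sq[½+δ]-mono-≤ (0≤ε (rank σ)) (ε-mono-≤ (term-rank≤threshold t c (v ∷ y) i<s))))
  near-bound true  y σ@(ref true  j c) _ _ =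
    Δ-refAnchor-toward true y (0≤ε (rank σ)) (ε≤1 (rank σ)) (0≤ε (threshold (true ∷ y)))
  near-bound false y σ@(ref false j c) _ _ =
    Δ-refAnchor-toward false y (0≤ε (rank σ)) (ε≤1 (rank σ)) (0≤ε (threshold (false ∷ y)))
  near-bound true  y (ref false j c) _ admitted = Δ-away-admitted false y j c admitted
  near-bound false y (ref true  j c) _ admitted = Δ-away-admitted true y j c admitted

  far-bound : ∀ v y σ → ¬ T (near (v ∷ y) σ) →
              sq (½ +ℚ ε (suc (threshold (v ∷ y)))) +ℚ Δ y ½s ≤ℚ Δ (v ∷ y) (anchor σ)
  far-bound v y σ@(term t i c) unsatisfied = ℚ.≤-trans
    (ℚ.+-monoˡ-≤ (Δ y ½s) (sq[½+ε]≤1 (suc (threshold (v ∷ y)))))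
    (Δ-termAnchor-forbidden v y (0≤ε (rank σ)) (ε≤¼ (rank σ)) (allowed t) j x∉t)
    where
    j,x∉t = evalAnd-forbids (v ∷ y) t unsatisfied
    j = proj₁ j,x∉t
    x∉t = proj₂ j,x∉t
  far-bound true  y (ref true  j c) ¬⊤       = ⊥-elim (¬⊤ _)
  far-bound false y (ref false j c) ¬⊤       = ⊥-elim (¬⊤ _)
  far-bound true  y (ref false j c) rejected = Δ-away-rejected false y j c rejected
  far-bound false y (ref true  j c) rejected = Δ-away-rejected true y j c rejected

  near-closer : ∀ x {σ τ} → IndexBounded σ → T (near x σ) → ¬ T (near x τ) → Δ x (anchor σ) <ℚ Δ x (anchor τ)
  near-closer (v ∷ y) {σ} {τ} bounded σ-near τ-far = ℚ.≤-<-trans (near-bound v y σ bounded σ-near)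
    (ℚ.<-≤-trans (ℚ.+-monoˡ-< (Δ y ½s) (sq[½+δ]-mono-< (0≤ε θ) (ε-mono-< (ℕ.n<1+n θ))))
                 (far-bound v y τ τ-far))
    where θ = threshold (v ∷ y)

  selected : Bool → Vec Bool (suc n) → Spec → Bool
  selected p x σ = near x σ ∧ (label σ == p)

  near-toward : ∀ v y j c → near (v ∷ y) (ref v j c) ≡ true
  near-toward true  y j c = refl
  near-toward false y j c = refl

  near-away : ∀ v y j c → near (v ∷ y) (ref (not v) j c) ≡ (toℕ c + 2 * j ℕ.≤ᵇ 2 * missing (v ∷ y))
  near-away true  y j c = refl
  near-away false y j c = refl

  module Count (p : Bool) (v : Bool) (y : Vec Bool n) where

    private
      x = v ∷ y
      m = missing x

    count-termSpecs : ∀ {k} (ts : Vec (AndTerm (suc n)) k) →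
                      count (selected p x) (termSpecs ts) ≡ weight (Vec.map (λ t → evalAnd t x) ts)
    count-termSpecs []       = refl
    count-termSpecs (t ∷ ts) = begin
      count (selected p x) (termSpecs (t ∷ ts))
        ≡⟨ count-pair-term p (evalAnd t x) _ ⟩
      toℕ (evalAnd t x) + count (selected p x) (termSpecs ts)
        ≡⟨ cong (toℕ (evalAnd t x) +_) (count-termSpecs ts) ⟩
      toℕ (evalAnd t x) + weight (Vec.map (λ t → evalAnd t x) ts)
        ≡⟨ weight-∷ (evalAnd t x) (Vec.map (λ t → evalAnd t x) ts) ⟨
      weight (Vec.map (λ t → evalAnd t x) (t ∷ ts))  ∎
      where open ≡-Reasoning

    count-toward : ∀ J → count (selected p x) (refSpecs v J) ≡ J
    count-toward zero    = refl
    count-toward (suc J) = trans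
      (count-pair-both p (G (s ∸ J)) _ (near-toward v y J true) (near-toward v y J false))
      (cong suc (count-toward J))

    admits : ∀ {j} c → toℕ c + 2 * j ≤ 2 * m → near x (ref (not v) j c) ≡ true
    admits {j} c le = trans (near-away v y j c) (Equivalence.to T-≡ (ℕ.≤⇒≤ᵇ le))

    rejects : ∀ {j} c → ¬ toℕ c + 2 * j ≤ 2 * m → near x (ref (not v) j c) ≡ false
    rejects {j} c ¬le = trans (near-away v y j c) (¬T⇒≡false (¬le ∘ ℕ.≤ᵇ⇒≤ (toℕ c + 2 * j) (2 * m)))
      where
      ¬T⇒≡false : ∀ {b} → ¬ T b → b ≡ false
      ¬T⇒≡false {true}  ¬⊤ = ⊥-elim (¬⊤ _)
      ¬T⇒≡false {false} _  = refl

    count-away-≤ : ∀ J → J ≤ m → count (selected p x) (refSpecs (not v) J) ≡ J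
    count-away-≤ zero    _   = refl
    count-away-≤ (suc J) J<m = trans
      (count-pair-both p (G (s ∸ J)) _ (admits {J} true (toℕ+2*-≤ true J<m))
                                       (admits {J} false (toℕ+2*-≤ false J<m)))
      (cong suc (count-away-≤ J (ℕ.<⇒≤ J<m)))

    count-away-> : ∀ J → m < J → count (selected p x) (refSpecs (not v) J) ≡ toℕ (G (s ∸ m) == p) + m
    count-away-> (suc J) (s≤s m≤J) with ℕ.m≤n⇒m<n∨m≡n m≤J
    ... | inj₂ refl = trans
      (count-pair-second p (G (s ∸ m)) _ (rejects {m} true (ℕ.<-irrefl refl)) (admits {m} false ℕ.≤-refl))
      (cong (toℕ (G (s ∸ m) == p) +_) (count-away-≤ m ℕ.≤-refl))
    ... | inj₁ m<J = trans
      (count-pair-none p (G (s ∸ J)) _ (rejects {J} true (too-far true)) (rejects {J} false (too-far false)))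
      (count-away-> J m<J)
      where
      too-far : ∀ c → ¬ toℕ c + 2 * J ≤ 2 * m
      too-far c le = ℕ.<-irrefl refl (ℕ.<-≤-trans (ℕ.*-monoʳ-< 2 m<J) (ℕ.≤-trans (ℕ.m≤n+m _ (toℕ c)) le))

  count-refSpecs : ∀ p v y → count (selected p (v ∷ y)) (refSpecs false (suc s)) +
                             count (selected p (v ∷ y)) (refSpecs true (suc s)) ≡
                             suc s + (toℕ (G (s ∸ missing (v ∷ y)) == p) + missing (v ∷ y))
  count-refSpecs p true  y = trans
    (cong₂ _+_ (Count.count-away-> p true y (suc s) (missing<1+s _)) (Count.count-toward p true y (suc s)))
    (ℕ.+-comm _ (suc s))
  count-refSpecs p false y =
    cong₂ _+_ (Count.count-toward p false y (suc s)) (Count.count-away-> p false y (suc s) (missing<1+s _))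

  count-specs : ∀ p x → count (selected p x) specs ≡ suc (s + s) + toℕ (G (weightAt x) == p)
  count-specs p x@(v ∷ y) = begin
    count (selected p x) specs
      ≡⟨ count-++ (selected p x) (refSpecs false (suc s)) _ ⟩
    cF + count (selected p x) (refSpecs true (suc s) ++ termSpecs h)
      ≡⟨ cong (cF +_) (count-++ (selected p x) (refSpecs true (suc s)) (termSpecs h)) ⟩
    cF + (cT + count (selected p x) (termSpecs h))
      ≡⟨ cong (λ k → cF + (cT + k)) (Count.count-termSpecs p v y h) ⟩
    cF + (cT + w)
      ≡⟨ ℕ.+-assoc cF cT w ⟨
    cF + cT + w
      ≡⟨ cong (_+ w) (count-refSpecs p v y) ⟩
    suc s + (t + m) + w
      ≡⟨ rearrange s t m w ⟩
    suc (s + (m + w)) + t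
      ≡⟨ cong₂ (λ k w → suc (s + k) + toℕ (G w == p)) (ℕ.m∸n+n≡m w≤s) (ℕ.m∸[m∸n]≡n w≤s) ⟩
    suc (s + s) + toℕ (G w == p)  ∎
    where
    open ≡-Reasoning
    cF = count (selected p x) (refSpecs false (suc s))
    cT = count (selected p x) (refSpecs true (suc s))
    w = weightAt x
    m = missing x
    t = toℕ (G (s ∸ m) == p)
    w≤s : w ≤ s
    w≤s = weight-≤ (Vec.map (λ t → evalAnd t x) h)
    rearrange : ∀ s t m w → suc s + (t + m) + w ≡ suc (s + (m + w)) + t
    rearrange = solve-∀

  anchorsWhere : (Spec → Bool) → List (Vec ℚ (suc n))
  anchorsWhere f = map anchor (filterᵇ f specs)

  labelled : Bool → List (Vec ℚ (suc n))
  labelled p = anchorsWhere (λ σ → label σ == p)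

  nearest : Bool → Vec Bool (suc n) → List (Vec ℚ (suc n))
  nearest p x = anchorsWhere (selected p x)

  unique-anchorsWhere : ∀ f → Unique (anchorsWhere f)
  unique-anchorsWhere f = AllPairs.map⁺ (AllPairs.filter⁺ (T? ∘ f) anchors-distinct)

  ∈-anchorsWhere⁻ : ∀ f {a} → a ∈ anchorsWhere f → ∃[ σ ] σ ∈ specs × a ≡ anchor σ × T (f σ)
  ∈-anchorsWhere⁻ f = ∈-map∘filter⁻ anchor (T? ∘ f)

  ∈-anchorsWhere⁺ : ∀ f {σ} → σ ∈ specs → T (f σ) → anchor σ ∈ anchorsWhere f
  ∈-anchorsWhere⁺ f σ∈specs fσ = ∈-map∘filter⁺ anchor (T? ∘ f) (_ , σ∈specs , refl , fσ)

  labelled-disjoint : ∀ {a} → a ∈ labelled true → a ∉ labelled false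
  labelled-disjoint a∈P a∈N
    with ∈-anchorsWhere⁻ (λ σ → label σ == true) a∈P | ∈-anchorsWhere⁻ (λ σ → label σ == false) a∈N
  ... | σ , σ∈specs , refl , σ⁺ | τ , τ∈specs , a≡τ , τ⁻
    with refl ← AllPairs-≢-injective rank ranks-distinct σ∈specs τ∈specs (anchor-injective σ τ a≡τ)
    = T-not σ⁺ τ⁻

  module _ (x : Vec Bool (suc n)) where

    nearest⊆labelled : ∀ p → nearest p x ⊆ labelled p
    nearest⊆labelled p a∈nearest with ∈-anchorsWhere⁻ (selected p x) a∈nearest
    ... | σ , σ∈specs , refl , σ-selected =
      ∈-anchorsWhere⁺ (λ σ → label σ == p) σ∈specs (proj₂ (Equivalence.to T-∧ σ-selected))

    nearest-isNearest : IsNearest x (labelled true) (labelled false) (nearest true x) (nearest false x)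
    nearest-isNearest = record
      { unique-P = unique-anchorsWhere (selected true x)
      ; unique-N = unique-anchorsWhere (selected false x)
      ; ⊆-P      = nearest⊆labelled true
      ; ⊆-N      = nearest⊆labelled false
      ; closer   = closer
      }
      where
      near-of : ∀ p {a} → a ∈ nearest p x → ∃[ σ ] σ ∈ specs × a ≡ anchor σ × T (near x σ)
      near-of p a∈nearest with ∈-anchorsWhere⁻ (selected p x) a∈nearest
      ... | σ , σ∈specs , a≡σ , σ-selected = σ , σ∈specs , a≡σ , proj₁ (Equivalence.to T-∧ σ-selected)

      spec-of : ∀ p {b} → b ∈ labelled p → ∃[ τ ] τ ∈ specs × b ≡ anchor τ
      spec-of p b∈labelled with ∈-anchorsWhere⁻ (λ σ → label σ == p) b∈labelled
      ... | τ , τ∈specs , b≡τ , _ = τ , τ∈specs , b≡τ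

      anchor∈nearest : ∀ {τ} → τ ∈ specs → T (near x τ) → anchor τ ∈ nearest true x ++ nearest false x
      anchor∈nearest {τ} τ∈specs τ-near = place (label τ)
        (∈-anchorsWhere⁺ (selected (label τ) x) τ∈specs (Equivalence.from T-∧ (τ-near , ==-refl (label τ))))
        where
        place : ∀ p → anchor τ ∈ nearest p x → anchor τ ∈ nearest true x ++ nearest false x
        place true  = ∈-++⁺ˡ
        place false = ∈-++⁺ʳ (nearest true x)

      closer : ∀ {a b} → a ∈ nearest true x ++ nearest false x → b ∈ labelled true ++ labelled false →
               b ∉ nearest true x ++ nearest false x → Δ x a <ℚ Δ x b
      closer a∈A b∈PN b∉A with [ near-of true , near-of false ]′ (∈-++⁻ (nearest true x) a∈A)
                             | [ spec-of true , spec-of false ]′ (∈-++⁻ (labelled true) b∈PN)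
      ... | σ , σ∈specs , refl , σ-near | τ , τ∈specs , refl =
        near-closer x (All.lookup specs-indexBounded σ∈specs) σ-near (b∉A ∘ anchor∈nearest τ∈specs)

  half : ℕ
  half = suc (s + s)

  length-nearest : ∀ p x → length (nearest p x) ≡ half + toℕ (G (weightAt x) == p)
  length-nearest p x = trans (length-map anchor (filterᵇ (selected p x) specs))
                             (trans (length-filterᵇ (selected p x) specs) (count-specs p x))

  nearest-size : ∀ x → length (nearest true x) + length (nearest false x) ≡ suc (half + half)
  nearest-size x =
    trans (cong₂ _+_ (length-nearest true x) (length-nearest false x)) (balance half (G (weightAt x)))
    where
    c+1+c : ∀ c → c + 1 + (c + 0) ≡ suc (c + c)
    c+1+c = solve-∀
    c+c+1 : ∀ c → c + 0 + (c + 1) ≡ suc (c + c)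
    c+c+1 = solve-∀
    balance : ∀ c g → c + toℕ g + (c + toℕ (not g)) ≡ suc (c + c)
    balance c true  = c+1+c c
    balance c false = c+c+1 c

  majority⇔G : ∀ x → length (nearest false x) ≤ length (nearest true x) ⇔ G (weightAt x) ≡ true
  majority⇔G x rewrite length-nearest true x | length-nearest false x = majority⇔ (G (weightAt x))
    where
    majority⇔ : ∀ g → half + toℕ (not g) ≤ half + toℕ g ⇔ g ≡ true
    majority⇔ true  = mk⇔ (λ _ → refl) (λ _ → ℕ.+-monoʳ-≤ half z≤n)
    majority⇔ false = mk⇔ (λ 1≤0 → ⊥-elim (ℕ.<-irrefl refl (ℕ.+-cancelˡ-≤ half 1 0 1≤0))) (λ ())

  representation : KNNRep (suc n) (λ x → G (weightAt x))
  representation = record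
    { P        = labelled true
    ; N        = labelled false
    ; k        = suc (half + half)
    ; k-pos    = s≤s z≤n
    ; uniqueP  = unique-anchorsWhere (λ σ → label σ == true)
    ; uniqueN  = unique-anchorsWhere (λ σ → label σ == false)
    ; disjoint = labelled-disjoint
    ; correct  = λ x → let open Equivalence (accepts⇔G x) in from , to
    }
    where
    majority : Vec Bool (suc n) → Set
    majority x = length (nearest false x) ≤ length (nearest true x)
    accepts⇔G : ∀ x → KNNAccepts (labelled true) (labelled false) (suc (half + half)) x ⇔ G (weightAt x) ≡ true
    accepts⇔G x = majority⇔G x ⇔-∘
      subst (λ k → KNNAccepts (labelled true) (labelled false) k x ⇔ majority x)
            (nearest-size x) (accepts⇔majority labelled-disjoint (nearest-isNearest x))

  number-of-anchors : length (labelled true) + length (labelled false) ≡ 6 * s + 4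
  number-of-anchors = begin
    length (labelled true) + length (labelled false)
      ≡⟨ cong₂ _+_ (length-map anchor (filterᵇ label specs)) (length-map anchor (filterᵇ (not ∘ label) specs)) ⟩
    length (filterᵇ label specs) + length (filterᵇ (not ∘ label) specs)
      ≡⟨ cong₂ _+_ (length-filterᵇ label specs) (length-filterᵇ (not ∘ label) specs) ⟩
    count label specs + count (not ∘ label) specs
      ≡⟨ count-+-count-not label specs ⟩
    length specs
      ≡⟨ length-map rank specs ⟨
    length (map rank specs)
      ≡⟨ cong length ranks-specs ⟩
    length (downFrom (2 * suc s + refBase false))
      ≡⟨ length-downFrom (2 * suc s + refBase false) ⟩
    2 * suc s + (2 * suc s + 2 * s)
      ≡⟨ six-s+4 s ⟩
    6 * s + 4  ∎
    where
    open ≡-Reasoning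
    six-s+4 : ∀ s → 2 * suc s + (2 * suc s + 2 * s) ≡ 6 * s + 4
    six-s+4 = solve-∀

symmetric∘and-representation : ∀ {n s} (hs : Vec (AndTerm (suc n)) s) (g : Vec Bool s → Bool) → Symmetric g →
                               KNNRep (suc n) (λ x → g (Vec.map (λ t → evalAnd t x) hs))
symmetric∘and-representation {s = s} hs g g-sym = KNNRep-resp g-of-weight (Construction.representation hs G)
  where
  G : ℕ → Bool
  G = g ∘ canonical s
  g-of-weight : ∀ x → G (Construction.weightAt hs G x) ≡ g (Vec.map (λ t → evalAnd t x) hs)
  g-of-weight x = g-sym _ _ (weight-canonical s (weight-≤ (Vec.map (λ t → evalAnd t x) hs)))

-- In dimension 0 there is a single point, so a single anchor decides.
constant-representation : ∀ b → KNNRep 0 (λ _ → b)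
constant-representation true = record
  { P = [] ∷ [] ; N = [] ; k = 1 ; k-pos = ℕ.≤-refl ; uniqueP = [] ∷ [] ; uniqueN = [] ; disjoint = λ _ ()
  ; correct = λ x →
      (λ _ → Equivalence.from (accepts⇔majority (λ _ ()) (whole-isNearest {x = x} ([] ∷ []) [])) z≤n)
    , (λ _ → refl)
  }
constant-representation false = record
  { P = [] ; N = [] ∷ [] ; k = 1 ; k-pos = ℕ.≤-refl ; uniqueP = [] ; uniqueN = [] ∷ [] ; disjoint = λ ()
  ; correct = λ x →
      (λ ())
    , (λ accepts → ⊥-elim (ℕ.<-irrefl refl
        (Equivalence.to (accepts⇔majority (λ ()) (whole-isNearest {x = x} [] ([] ∷ []))) accepts)))
  }

constant-representation-size : ∀ b →
  length (KNNRep.P (constant-representation b)) + length (KNNRep.N (constant-representation b)) ≡ 1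
constant-representation-size true  = refl
constant-representation-size false = refl

-- Polynomial bounds

PolyBounded-mono : ∀ {f g} → (∀ n → f n ≤ g n) → PolyBounded g → PolyBounded f
PolyBounded-mono f≤g (c , g≤) = c , λ n → ℕ.≤-trans (f≤g n) (g≤ n)

*-≤-square : ∀ a x → a * x ≤ x * x + a * a
*-≤-square a x with ℕ.≤-total a x
... | inj₁ a≤x = ℕ.≤-trans (ℕ.*-monoˡ-≤ x a≤x) (ℕ.m≤m+n (x * x) (a * a))
... | inj₂ x≤a = ℕ.≤-trans (ℕ.*-monoʳ-≤ a x≤a) (ℕ.m≤n+m (a * a) (x * x))

^-≤-^-+1 : ∀ n {e e′} → e ≤ e′ → n ^ e ≤ n ^ e′ + 1
^-≤-^-+1 zero    {zero}  _    = ℕ.m≤n+m 1 _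
^-≤-^-+1 zero    {suc e} _    = z≤n
^-≤-^-+1 (suc n) e≤e′ = ℕ.≤-trans (ℕ.^-monoʳ-≤ (suc n) e≤e′) (ℕ.m≤m+n _ 1)

PolyBounded-affine : ∀ a b {s} → PolyBounded s → PolyBounded (λ n → a * s n + b)
PolyBounded-affine a b {s} (c , s≤) = c + c + suc K , λ n → begin
  a * s n + b                          ≤⟨ ℕ.+-monoˡ-≤ b (ℕ.*-monoʳ-≤ a (s≤ n)) ⟩
  a * (n ^ c + c) + b                  ≡⟨ distribute a b c (n ^ c) ⟩
  a * n ^ c + (a * c + b)              ≤⟨ ℕ.+-monoˡ-≤ (a * c + b) (*-≤-square a (n ^ c)) ⟩
  n ^ c * n ^ c + a * a + (a * c + b)  ≡⟨ regroup a b c (n ^ c * n ^ c) ⟩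
  n ^ c * n ^ c + K                    ≡⟨ cong (_+ K) (ℕ.^-distribˡ-+-* n c c) ⟨
  n ^ (c + c) + K                      ≤⟨ ℕ.+-monoˡ-≤ K (^-≤-^-+1 n (ℕ.m≤m+n (c + c) (suc K))) ⟩
  n ^ (c + c + suc K) + 1 + K          ≡⟨ ℕ.+-assoc (n ^ (c + c + suc K)) 1 K ⟩
  n ^ (c + c + suc K) + suc K          ≤⟨ ℕ.+-monoʳ-≤ (n ^ (c + c + suc K)) (ℕ.m≤n+m (suc K) (c + c)) ⟩
  n ^ (c + c + suc K) + (c + c + suc K)  ∎
  where
  open ℕ.≤-Reasoning
  K = a * a + a * c + b
  distribute : ∀ a b c x → a * (x + c) + b ≡ a * x + (a * c + b)
  distribute = solve-∀
  regroup : ∀ a b c y → y + a * a + (a * c + b) ≡ y + (a * a + a * c + b)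
  regroup = solve-∀

theorem7 : (f : BoolFamily) → SYM∘AND f → kNN f
theorem7 f (s , s-poly , circuit) = representation , PolyBounded-mono size≤ (PolyBounded-affine 6 4 s-poly)
  where
  representation : (n : ℕ) → KNNRep n (f n)
  representation zero    = KNNRep-resp (λ { [] → refl }) (constant-representation (f 0 []))
  representation (suc n) = let (g , g-sym , hs , f≡g) = circuit (suc n) in
    KNNRep-resp (sym ∘ f≡g) (symmetric∘and-representation hs g g-sym)

  size≤ : ∀ n → length (KNNRep.P (representation n)) + length (KNNRep.N (representation n)) ≤ 6 * s n + 4
  size≤ zero    = ℕ.≤-trans (ℕ.≤-reflexive (constant-representation-size (f 0 [])))
                            (ℕ.≤-trans (s≤s z≤n) (ℕ.m≤n+m 4 (6 * s 0)))
  size≤ (suc n) = let (g , _ , hs , _) = circuit (suc n) in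
    ℕ.≤-reflexive (Construction.number-of-anchors hs (g ∘ canonical (s (suc n))))
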